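{- Let $G$ be a finite simple graph of order $n$ having $m$ connected components, none of which has order less than $3$, and let $p$ be the smallest prime number greater than $2^{n-m-1}$. Then $s_g(G)\leq p$.
   Context: For an Abelian group $\mathcal{G}$ and an edge labeling $f:E(G)\to\mathcal{G}$, the weighted degree of a vertex $v$ is $w(v)=\sum_{u\in N(v)} f(uv)$ (sum in $\mathcal{G}$). The labeling $f$ is $\mathcal{G}$-irregular if all weighted degrees are pairwise distinct. The group irregularity strength $s_g(G)$ is the smallest integer $s$ such that for every Abelian group $\mathcal{G}$ of order $s$ there exists a $\mathcal{G}$-irregular labeling of $G$. -}

module Defs where

open import Level using (0ℓ)
open import Data.Nat using (ℕ; zero; suc; _≤_; _<_; _∸_; _^_)
open import Data.Nat.Primality using (Prime)
open import Data.Fin using (Fin)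
open import Data.Bool using (Bool; true; false; if_then_else_)
open import Data.Product using (Σ; ∃; _×_; _,_)
open import Relation.Binary.PropositionalEquality using (_≡_)
open import Relation.Nullary using (¬_)
open import Function.Bundles using (_⇔_)
open import Algebra.Bundles using (AbelianGroup)

record SimpleGraph (n : ℕ) : Set where
  field
    adj   : Fin n → Fin n → Bool
    sym   : ∀ u v → adj u v ≡ adj v u
    irrefl : ∀ v → adj v v ≡ false

open SimpleGraph public

data Reachable {n : ℕ} (G : SimpleGraph n) : Fin n → Fin n → Set where
  here : ∀ {v} → Reachable G v v
  step : ∀ {u v w} → adj G u v ≡ true → Reachable G v w → Reachable G u w

-- G has exactly m connected components: there is a surjective
-- assignment c of vertices to component indices in Fin m such that two
-- vertices get the same index iff they are joined by a walk.
record ComponentStructure {n : ℕ} (G : SimpleGraph n) (m : ℕ) : Set where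
  field
    comp      : Fin n → Fin m
    comp-surj : ∀ k → ∃ λ v → comp v ≡ k
    comp-iff  : ∀ u v → (comp u ≡ comp v) ⇔ Reachable G u v

AllComponentsOrderAtLeast3 : ∀ {n m} {G : SimpleGraph n} → ComponentStructure G m → Set
AllComponentsOrderAtLeast3 {n} {m} C =
  ∀ (k : Fin m) → Σ (Fin n) λ u → Σ (Fin n) λ v → Σ (Fin n) λ w →
    ¬ u ≡ v × ¬ u ≡ w × ¬ v ≡ w ×
    ComponentStructure.comp C u ≡ k × ComponentStructure.comp C v ≡ k × ComponentStructure.comp C w ≡ k

module _ (A : AbelianGroup 0ℓ 0ℓ) where
  open AbelianGroup A

  HasOrder : ℕ → Set
  HasOrder s = Σ (Fin s → Carrier) λ e →
    (∀ i j → e i ≈ e j → i ≡ j) × (∀ x → ∃ λ i → e i ≈ x)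

  gsum : ∀ {k} → (Fin k → Carrier) → Carrier
  gsum {zero}  f = ε
  gsum {suc k} f = f Fin.zero ∙ gsum (λ i → f (Fin.suc i))
    where import Data.Fin as Fin

  -- An edge labeling: a symmetric function on ordered vertex pairs
  -- (only its values on edges matter).
  record EdgeLabeling {n : ℕ} (G : SimpleGraph n) : Set where
    field
      lab     : Fin n → Fin n → Carrier
      lab-sym : ∀ u v → lab u v ≈ lab v u

  weightedDegree : ∀ {n} {G : SimpleGraph n} → EdgeLabeling G → Fin n → Carrier
  weightedDegree {G = G} f v =
    gsum (λ u → if adj G v u then EdgeLabeling.lab f v u else ε)

  IsIrregular : ∀ {n} {G : SimpleGraph n} → EdgeLabeling G → Set
  IsIrregular {n} f = ∀ (u v : Fin n) → weightedDegree f u ≈ weightedDegree f v → u ≡ v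

-- s has the defining property of s_g: every Abelian group of order s
-- admits a G-irregular labeling.
GoodOrder : ∀ {n} → SimpleGraph n → ℕ → Set₁
GoodOrder G s = ∀ (A : AbelianGroup 0ℓ 0ℓ) → HasOrder A s →
  Σ (EdgeLabeling A G) λ f → IsIrregular A f

-- s_g(G) ≤ p : the least positive integer s with the defining property
-- is at most p, i.e. some positive s ≤ p has the property.
sg≤ : ∀ {n} → SimpleGraph n → ℕ → Set₁
sg≤ G p = Σ ℕ λ s → 1 ≤ s × s ≤ p × GoodOrder G s

IsSmallestPrimeAbove : ℕ → ℕ → Set
IsSmallestPrimeAbove b p = Prime p × b < p × (∀ q → Prime q → b < q → p ≤ q)

-- In every component pick a vertex c with two distinct neighbours a and b (a connected graph on at
-- least three vertices contains such a cherry).  Labelling the edges of a walk from c to u alternately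
-- with x and x ⁻¹ changes weighted degrees only at u, by x, and at c.  Summing such walk labellings,
-- all vertices except the corners of the cherries get prescribed pairwise distinct weights, the
-- corners a and b get weight ε and each centre c some offset d.  Labelling ca by x and cb by y then
-- gives a, b, c the weights x, y and d x y.  Choosing x and y component by component, x must avoid
-- d ⁻¹ and the at most n − 3 weights of the other vertices, and y additionally x and the translates
-- of those weights by (d x) ⁻¹: at most 2n − 4 values, so any abelian group of order p ≥ 2n − 3
-- admits an irregular labelling.  Since every component has at least three vertices,
-- 2 ^ (n − m − 1) ≥ 2n − 4, so p > 2 ^ (n − m − 1) suffices.

module Submission where

open import Level using (0ℓ)
open import Algebra.Bundles using (AbelianGroup)
open import Data.Bool using (Bool; true; false; if_then_else_)
open import Data.Empty using (⊥-elim)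
open import Data.Fin using (Fin; zero; suc; combine; remQuot; inject≤)
open import Data.Fin.Patterns using (0F; 1F; 2F)
open import Data.Fin.Properties
  using ( _≟_; ¬Fin0; suc-injective; any?; ¬∀⟶∃¬; <⇒notInjective; injective⇒≤; combine-remQuot
        ; inject≤-injective)
open import Data.List using (List; []; _∷_; _++_; map; length; lookup; filter; allFin)
open import Data.List.Properties using (length-map; length-++; length-tabulate; filter-notAll)
open import Data.List.Membership.Propositional using (_∈_; _∉_)
open import Data.List.Membership.Propositional.Properties using (∈-map⁺; ∈-filter⁺; ∈-allFin)
open import Data.List.Membership.DecPropositional using () renaming (_∈?_ to ∈?)
open import Data.List.Relation.Unary.All as All using (All; _∷_)
open import Data.List.Relation.Unary.All.Properties using (++⁻; map⁻)
open import Data.List.Relation.Unary.Any as Any using (here; there)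
open import Data.List.Relation.Unary.Any.Properties using (lookup-index)
open import Data.Nat using (ℕ; zero; suc; _+_; _*_; _∸_; _^_; _≤_; _<_; z≤n; s≤s)
open import Data.Nat.Properties
  using ( ≤-refl; ≤-reflexive; ≤-trans; ≤-<-trans; <⇒≱; m≤m+n; m≤n⇒m≤1+n; m≤n*m; m+[n∸m]≡n
        ; +-identityʳ; +-assoc; *-comm; *-distribˡ-+; +-monoˡ-≤; +-monoʳ-≤; *-monoʳ-≤; ^-monoʳ-≤
        ; +-cancelˡ-≤; +-cancelʳ-≤; module ≤-Reasoning)
open import Data.Nat.Tactic.RingSolver using (solve-∀)
open import Data.Product using (Σ; ∃; _×_; _,_; proj₁; proj₂; uncurry)
open import Data.Sum using (_⊎_; inj₁; inj₂)
open import Data.Vec.Functional using (updateAt)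
open import Data.Vec.Functional.Properties using (updateAt-updates; updateAt-minimal)
open import Function using (_∘_; const; Equivalence)
open import Relation.Binary.PropositionalEquality as ≡ using (_≡_; _≢_)
open import Relation.Nullary using (¬_; Dec; does; yes; no; ¬?)
open import Relation.Nullary.Decidable using (dec-true; dec-false)
open import Defs hiding (sym)

module FiniteSums {c ℓ} (A : AbelianGroup c ℓ) where

  open AbelianGroup A
  open import Algebra.Properties.CommutativeMonoid.Sum commutativeMonoid public
    using (sum; sum-cong-≋; sum-cong-≗; ∑-distrib-+; ∑-comm)
  open import Algebra.Properties.CommutativeMonoid.Sum commutativeMonoid using (sum-replicate-zero)
  open import Relation.Binary.Reasoning.Setoid setoid

  when : Bool → Carrier → Carrier
  when b x = if b then x else ε

  δ : ∀ {k} → Fin k → Fin k → Carrier → Carrier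
  δ i j = when (does (i ≟ j))

  when-∙ : ∀ b x y → when b (x ∙ y) ≈ when b x ∙ when b y
  when-∙ true  x y = refl
  when-∙ false x y = sym (identityˡ ε)

  when-ε : ∀ b → when b ε ≡ ε
  when-ε true  = ≡.refl
  when-ε false = ≡.refl

  when-comm : ∀ b b′ x → when b (when b′ x) ≡ when b′ (when b x)
  when-comm true  true  x = ≡.refl
  when-comm true  false x = ≡.refl
  when-comm false true  x = ≡.refl
  when-comm false false x = ≡.refl

  when-inverseˡ : ∀ b x → when b (x ⁻¹) ∙ when b x ≈ ε
  when-inverseˡ true  x = inverseˡ x
  when-inverseˡ false x = identityˡ ε

  δ-comm : ∀ {k l} (i j : Fin k) (i′ j′ : Fin l) x → δ i j (δ i′ j′ x) ≡ δ i′ j′ (δ i j x)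
  δ-comm i j i′ j′ = when-comm (does (i ≟ j)) (does (i′ ≟ j′))

  δ-self : ∀ {k} (i : Fin k) x → δ i i x ≡ x
  δ-self i x rewrite dec-true (i ≟ i) ≡.refl = ≡.refl

  δ-≢ : ∀ {k} {i j : Fin k} x → i ≢ j → δ i j x ≡ ε
  δ-≢ {i = i} {j} x i≢j rewrite dec-false (i ≟ j) i≢j = ≡.refl

  δ-sym : ∀ {k} (i j : Fin k) x → δ i j x ≡ δ j i x
  δ-sym i j x with i ≟ j | j ≟ i
  ... | yes _   | yes _   = ≡.refl
  ... | yes i≡j | no  j≢i = ⊥-elim (j≢i (≡.sym i≡j))
  ... | no  i≢j | yes j≡i = ⊥-elim (i≢j (≡.sym j≡i))
  ... | no  _   | no  _   = ≡.refl

  sum-zero : ∀ {k} {f : Fin k → Carrier} → (∀ i → f i ≈ ε) → sum f ≈ ε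
  sum-zero {k} f≈ε = trans (sum-cong-≋ f≈ε) (sum-replicate-zero k)

  sum-supported : ∀ {k} (f : Fin k → Carrier) i → (∀ j → j ≢ i → f j ≈ ε) → sum f ≈ f i
  sum-supported {suc k} f zero f≈ε = begin
    f zero ∙ sum (f ∘ suc) ≈⟨ ∙-congˡ (sum-zero λ j → f≈ε (suc j) λ ()) ⟩
    f zero ∙ ε             ≈⟨ identityʳ (f zero) ⟩
    f zero                 ∎
  sum-supported {suc k} f (suc i) f≈ε = begin
    f zero ∙ sum (f ∘ suc)
      ≈⟨ ∙-cong (f≈ε zero λ ()) (sum-supported (f ∘ suc) i λ j j≢i → f≈ε (suc j) (j≢i ∘ suc-injective)) ⟩
    ε ∙ f (suc i)
      ≈⟨ identityˡ (f (suc i)) ⟩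
    f (suc i) ∎

  sum-δ : ∀ {k} (i : Fin k) (f : Fin k → Carrier) → sum (λ j → δ i j (f j)) ≈ f i
  sum-δ i f = trans (sum-supported _ i λ j j≢i → reflexive (δ-≢ (f j) (j≢i ∘ ≡.sym))) (reflexive (δ-self i (f i)))

  when-sum : ∀ b {k} (f : Fin k → Carrier) → when b (sum f) ≈ sum (λ j → when b (f j))
  when-sum true        f = refl
  when-sum false {k} f = sym (sum-zero {k} λ _ → refl)

gsum≡sum : ∀ (A : AbelianGroup 0ℓ 0ℓ) {k} (f : Fin k → AbelianGroup.Carrier A) → gsum A f ≡ FiniteSums.sum A f
gsum≡sum A {zero}  f = ≡.refl
gsum≡sum A {suc k} f = ≡.cong (AbelianGroup._∙_ A (f zero)) (gsum≡sum A (f ∘ suc))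

length<⇒∃∉ : ∀ {p} (is : List (Fin p)) → length is < p → ∃ λ i → i ∉ is
length<⇒∃∉ {p} is |is|<p = ¬∀⟶∃¬ p (_∈ is) (λ i → ∈? _≟_ i is) λ all∈ →
  <⇒notInjective |is|<p λ {i} {j} eq →
    ≡.trans (lookup-index (all∈ i)) (≡.trans (≡.cong (lookup is) eq) (≡.sym (lookup-index (all∈ j))))

without : ∀ {n} → Fin n → List (Fin n) → List (Fin n)
without v = filter (λ u → ¬? (u ≟ v))

length-without : ∀ {n} {v : Fin n} {us} → v ∈ us → suc (length (without v us)) ≤ length us
length-without v∈us = filter-notAll _ _ (Any.map (λ v≡u u≢v → u≢v (≡.sym v≡u)) v∈us)

∈-without : ∀ {n} {u v : Fin n} {us} → u ∈ us → u ≢ v → u ∈ without v us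
∈-without = ∈-filter⁺ _

module FreshValues (A : AbelianGroup 0ℓ 0ℓ) {p} (order : HasOrder A p) where

  open AbelianGroup A
  open import Algebra.Properties.AbelianGroup A using (y≈x\\z; ∙-cancelʳ; inverseʳ-unique)
  open import Algebra.Properties.CommutativeSemigroup commutativeSemigroup using (xy∙z≈xz∙y)
  open import Relation.Binary.Reasoning.Setoid setoid

  private
    2+[n+n]≡2*n+2 : ∀ n → 2 + (n + n) ≡ 2 * n + 2
    2+[n+n]≡2*n+2 = solve-∀
    e : Fin p → Carrier
    e = proj₁ order
    e-injective : ∀ i j → e i ≈ e j → i ≡ j
    e-injective = proj₁ (proj₂ order)
    position : Carrier → Fin p
    position z = proj₁ (proj₂ (proj₂ order) z)
    e-position : ∀ z → e (position z) ≈ z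
    e-position z = proj₂ (proj₂ (proj₂ order) z)

  Fresh : Carrier → List Carrier → Set
  Fresh x = All (λ z → ¬ x ≈ z)

  fresh : ∀ zs → length zs < p → ∃ λ x → Fresh x zs
  fresh zs |zs|<p with length<⇒∃∉ (map position zs) (≡.subst (_< p) (≡.sym (length-map position zs)) |zs|<p)
  ... | i , i∉ = e i , All.tabulate λ {z} z∈zs eᵢ≈z →
    i∉ (≡.subst (_∈ _) (≡.sym (e-injective _ _ (trans eᵢ≈z (sym (e-position z))))) (∈-map⁺ position z∈zs))

  record FreshTriple (zs : List Carrier) (d : Carrier) : Set where
    field
      x y       : Carrier
      x-fresh   : Fresh x zs
      y-fresh   : Fresh y zs
      dxy-fresh : Fresh (d ∙ x ∙ y) zs
      x≉y       : ¬ x ≈ y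
      dxy≉x     : ¬ d ∙ x ∙ y ≈ x
      dxy≉y     : ¬ d ∙ x ∙ y ≈ y

  private
    room-for-x : ∀ zs d → 2 * length zs + 2 < p → length (d ⁻¹ ∷ zs) < p
    room-for-x zs d bound =
      ≤-<-trans (s≤s (m≤n⇒m≤1+n (m≤m+n L L))) (≡.subst (_< p) (≡.sym (2+[n+n]≡2*n+2 L)) bound)
      where
        L : ℕ
        L = length zs
    room-for-y : ∀ zs d x → 2 * length zs + 2 < p → length (x ∷ d ⁻¹ ∷ zs ++ map ((d ∙ x) ⁻¹ ∙_) zs) < p
    room-for-y zs d x = ≡.subst (_< p) (≡.sym (≡.trans
      (≡.cong (2 +_) (≡.trans (length-++ zs) (≡.cong (length zs +_) (length-map _ zs)))) (2+[n+n]≡2*n+2 (length zs))))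

  -- x avoids d ⁻¹ (forcing dxy ≉ y); y avoids x, d ⁻¹ (forcing dxy ≉ x) and each (d ∙ x) ⁻¹ ∙ z, z ∈ zs.
  freshTriple : ∀ zs d → 2 * length zs + 2 < p → FreshTriple zs d
  freshTriple zs d bound
    with x , x≉d⁻¹ ∷ x-fresh ← fresh (d ⁻¹ ∷ zs) (room-for-x zs d bound)
    with y , y≉x ∷ y≉d⁻¹ ∷ y-avoids
           ← fresh (x ∷ d ⁻¹ ∷ zs ++ map ((d ∙ x) ⁻¹ ∙_) zs) (room-for-y zs d x bound)
    with y-fresh , y-shifted ← ++⁻ zs y-avoids = record
    { x = x ; y = y ; x-fresh = x-fresh ; y-fresh = y-fresh
    ; dxy-fresh = All.tabulate λ {z} z∈zs dxy≈z → All.lookup (map⁻ y-shifted) z∈zs (y≈x\\z (d ∙ x) y z dxy≈z)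
    ; x≉y = λ x≈y → y≉x (sym x≈y)
    ; dxy≉x = λ dxy≈x → y≉d⁻¹ (inverseʳ-unique d y (∙-cancelʳ x (d ∙ y) ε (begin
        d ∙ y ∙ x ≈⟨ xy∙z≈xz∙y d y x ⟩
        d ∙ x ∙ y ≈⟨ dxy≈x ⟩
        x         ≈⟨ identityˡ x ⟨
        ε ∙ x     ∎)))
    ; dxy≉y = λ dxy≈y →
        x≉d⁻¹ (inverseʳ-unique d x (∙-cancelʳ y (d ∙ x) ε (trans dxy≈y (sym (identityˡ y)))))
    }

3*[3+e]≤2^[3+e]+1 : ∀ e → 3 * (3 + e) ≤ 2 ^ (3 + e) + 1
3*[3+e]≤2^[3+e]+1 zero    = ≤-refl
3*[3+e]≤2^[3+e]+1 (suc e) = begin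
  3 * (4 + e)                   ≡⟨ 3*[4+e]≡3*[3+e]+3 e ⟩
  3 * (3 + e) + 3               ≤⟨ +-monoˡ-≤ 3 (3*[3+e]≤2^[3+e]+1 e) ⟩
  2 ^ (3 + e) + 1 + 3           ≤⟨ +-monoʳ-≤ (2 ^ (3 + e) + 1) 3≤2^[3+e] ⟩
  2 ^ (3 + e) + 1 + 2 ^ (3 + e) ≡⟨ P+1+P≡2*P+1 (2 ^ (3 + e)) ⟩
  2 ^ (4 + e) + 1               ∎
  where
    open ≤-Reasoning
    3≤2^[3+e] : 3 ≤ 2 ^ (3 + e)
    3≤2^[3+e] = ≤-trans (s≤s (s≤s (s≤s z≤n))) (^-monoʳ-≤ 2 (s≤s (s≤s (z≤n {1 + e}))))
    3*[4+e]≡3*[3+e]+3 : ∀ e → 3 * (4 + e) ≡ 3 * (3 + e) + 3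
    3*[4+e]≡3*[3+e]+3 = solve-∀
    P+1+P≡2*P+1 : ∀ P → P + 1 + P ≡ 2 * P + 1
    P+1+P≡2*P+1 = solve-∀

-- Tight for e = 1, 2, 3; for e ≤ 2 the hypothesis leaves only m ≤ 1.
2*[e+m]≤2^e+2 : ∀ e m → 2 * m ≤ suc e → 2 * (e + m) ≤ 2 ^ e + 2
2*[e+m]≤2^e+2 0 0             _    = z≤n
2*[e+m]≤2^e+2 1 0             _    = s≤s (s≤s z≤n)
2*[e+m]≤2^e+2 1 1             _    = ≤-refl
2*[e+m]≤2^e+2 2 0             _    = s≤s (s≤s (s≤s (s≤s z≤n)))
2*[e+m]≤2^e+2 2 1             _    = ≤-refl
2*[e+m]≤2^e+2 0 (suc m)       2m≤1 =
  ⊥-elim (<⇒≱ (s≤s ≤-refl) (≤-trans (*-monoʳ-≤ 2 (s≤s (z≤n {m}))) 2m≤1))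
2*[e+m]≤2^e+2 1 (suc (suc m)) 2m≤2 =
  ⊥-elim (<⇒≱ (s≤s (s≤s (s≤s z≤n))) (≤-trans (*-monoʳ-≤ 2 (s≤s (s≤s (z≤n {m})))) 2m≤2))
2*[e+m]≤2^e+2 2 (suc (suc m)) 2m≤3 =
  ⊥-elim (<⇒≱ ≤-refl (≤-trans (*-monoʳ-≤ 2 (s≤s (s≤s (z≤n {m})))) 2m≤3))
2*[e+m]≤2^e+2 (suc (suc (suc e))) m 2m≤1+E = begin
  2 * (E + m)   ≡⟨ *-distribˡ-+ 2 E m ⟩
  2 * E + 2 * m ≤⟨ +-monoʳ-≤ (2 * E) 2m≤1+E ⟩
  2 * E + suc E ≡⟨ 2*E+[1+E]≡3*E+1 E ⟩
  3 * E + 1     ≤⟨ +-monoˡ-≤ 1 (3*[3+e]≤2^[3+e]+1 e) ⟩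
  2 ^ E + 1 + 1 ≡⟨ +-assoc (2 ^ E) 1 1 ⟩
  2 ^ E + 2     ∎
  where
    open ≤-Reasoning
    E : ℕ
    E = 3 + e
    2*E+[1+E]≡3*E+1 : ∀ E → 2 * E + suc E ≡ 3 * E + 1
    2*E+[1+E]≡3*E+1 = solve-∀

2*[m+k]≤p+3 : ∀ m k p → 3 * m ≤ m + k → 2 ^ (k ∸ 1) < p → 2 * (m + k) ≤ p + 3
2*[m+k]≤p+3 m zero p 3m≤m+0 _ = ≤-trans (≤-reflexive (≡.cong (2 *_) (+-identityʳ m)))
  (≤-trans (+-cancelʳ-≤ m (2 * m) 0 (≡.subst₂ _≤_ (3*m≡2*m+m m) (+-identityʳ m) 3m≤m+0)) z≤n)
  where
    3*m≡2*m+m : ∀ m → 3 * m ≡ 2 * m + m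
    3*m≡2*m+m = solve-∀
2*[m+k]≤p+3 m (suc e) p 3m≤m+k 2^e<p = begin
  2 * (m + suc e) ≡⟨ 2*[m+1+e]≡2*[e+m]+2 m e ⟩
  2 * (e + m) + 2 ≤⟨ +-monoˡ-≤ 2 (2*[e+m]≤2^e+2 e m 2m≤1+e) ⟩
  2 ^ e + 2 + 2   ≡⟨ P+2+2≡[1+P]+3 (2 ^ e) ⟩
  suc (2 ^ e) + 3 ≤⟨ +-monoˡ-≤ 3 2^e<p ⟩
  p + 3           ∎
  where
    open ≤-Reasoning
    3*m≡m+2*m : ∀ m → 3 * m ≡ m + 2 * m
    3*m≡m+2*m = solve-∀
    2*[m+1+e]≡2*[e+m]+2 : ∀ m e → 2 * (m + suc e) ≡ 2 * (e + m) + 2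
    2*[m+1+e]≡2*[e+m]+2 = solve-∀
    P+2+2≡[1+P]+3 : ∀ P → P + 2 + 2 ≡ suc P + 3
    P+2+2≡[1+P]+3 = solve-∀
    2m≤1+e : 2 * m ≤ suc e
    2m≤1+e = +-cancelˡ-≤ m _ _ (≡.subst (_≤ m + suc e) (3*m≡m+2*m m) 3m≤m+k)

2*order≤p+3 : ∀ {n m p} → 3 * m ≤ n → 2 ^ (n ∸ m ∸ 1) < p → 2 * n ≤ p + 3
2*order≤p+3 {n} {m} {p} 3m≤n 2^e<p =
  ≡.subst (λ n → 2 * n ≤ p + 3) m+k≡n
    (2*[m+k]≤p+3 m (n ∸ m) p (≡.subst (3 * m ≤_) (≡.sym m+k≡n) 3m≤n) 2^e<p)
  where
    m+k≡n : m + (n ∸ m) ≡ n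
    m+k≡n = m+[n∸m]≡n (≤-trans (m≤n*m m 3) 3m≤n)

order≤p : ∀ {n m p} → (Fin n → Fin m) → 3 * m ≤ n → 2 * n ≤ p + 3 → n ≤ p
order≤p {zero}              _    _    _      = z≤n
order≤p {suc n} {zero}      comp _    _      = ⊥-elim (¬Fin0 (comp zero))
order≤p {suc n} {suc m} {p} _    3m≤n 2n≤p+3 = +-cancelʳ-≤ 3 (suc n) p
  (≤-trans (+-monoʳ-≤ (suc n) (≤-trans (*-monoʳ-≤ 3 (s≤s (z≤n {m}))) 3m≤n))
           (≡.subst (_≤ p + 3) (≡.cong (suc n +_) (+-identityʳ (suc n))) 2n≤p+3))

3+l≤n⇒2*l+2<p : ∀ {l n p} → 3 + l ≤ n → 2 * n ≤ p + 3 → 2 * l + 2 < p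
3+l≤n⇒2*l+2<p {l} {n} {p} 3+l≤n 2n≤p+3 =
  +-cancelʳ-≤ 3 _ _ (≡.subst (_≤ p + 3) (2*[3+l]≡2*l+2+4 l) (≤-trans (*-monoʳ-≤ 2 3+l≤n) 2n≤p+3))
  where
    2*[3+l]≡2*l+2+4 : ∀ l → 2 * (3 + l) ≡ suc (2 * l + 2) + 3
    2*[3+l]≡2*l+2+4 = solve-∀

module _ {n} (G : SimpleGraph n) where

  adjacent⇒≢ : ∀ {u v} → adj G u v ≡ true → u ≢ v
  adjacent⇒≢ {u} uv ≡.refl with ≡.trans (≡.sym uv) (irrefl G u)
  ... | ()

  record Cherry (y : Fin n) : Set where
    field
      centre left right : Fin n
      centre-left  : adj G centre left ≡ true
      centre-right : adj G centre right ≡ true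
      left≢right   : left ≢ right
      reach        : Reachable G y centre

  cherry-step : ∀ {y z} → adj G y z ≡ true → Cherry z → Cherry y
  cherry-step yz c = record { Cherry c ; reach = step yz (Cherry.reach c) }

  cherry-on-walk : ∀ {y z t} → adj G y z ≡ true → Reachable G y t → t ≢ y → t ≢ z → Cherry y
  cherry-on-walk yz here t≢y t≢z = ⊥-elim (t≢y ≡.refl)
  cherry-on-walk {y} {z} yz (step {v = z′} yz′ z′t) t≢y t≢z with z′ ≟ z
  ... | no z′≢z = record
    { centre = y ; left = z ; right = z′ ; centre-left = yz ; centre-right = yz′
    ; left≢right = z′≢z ∘ ≡.sym ; reach = here }
  ... | yes ≡.refl = cherry-step yz (cherry-on-walk (≡.trans (SimpleGraph.sym G z y) yz) z′t t≢z t≢y)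

  cherry-of-three : ∀ {u v w} → Reachable G u v → Reachable G u w →
                    u ≢ v → u ≢ w → v ≢ w → Cherry u
  cherry-of-three here uw u≢v u≢w v≢w = ⊥-elim (u≢v ≡.refl)
  cherry-of-three {v = v} (step {v = z} uz zv) uw u≢v u≢w v≢w with v ≟ z
  ... | no v≢z = cherry-on-walk uz (step uz zv) (u≢v ∘ ≡.sym) v≢z
  ... | yes ≡.refl = cherry-on-walk uz uw (u≢w ∘ ≡.sym) (v≢w ∘ ≡.sym)

record ComponentCherries {n m} (G : SimpleGraph n) (comp : Fin n → Fin m) : Set where
  field
    centre left right : Fin m → Fin n
    comp-centre  : ∀ k → comp (centre k) ≡ k
    comp-left    : ∀ k → comp (left k) ≡ k
    comp-right   : ∀ k → comp (right k) ≡ k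
    centre-left  : ∀ k → adj G (centre k) (left k) ≡ true
    centre-right : ∀ k → adj G (centre k) (right k) ≡ true
    left≢right   : ∀ k → left k ≢ right k

  corner : Fin m → Fin 3 → Fin n
  corner k 0F = centre k
  corner k 1F = left k
  corner k 2F = right k

  comp-corner : ∀ k i → comp (corner k i) ≡ k
  comp-corner k 0F = comp-centre k
  comp-corner k 1F = comp-left k
  comp-corner k 2F = comp-right k

  corner-injective : ∀ k i j → corner k i ≡ corner k j → i ≡ j
  corner-injective k 0F 0F _ = ≡.refl
  corner-injective k 0F 1F eq = ⊥-elim (adjacent⇒≢ G (centre-left k) eq)
  corner-injective k 0F 2F eq = ⊥-elim (adjacent⇒≢ G (centre-right k) eq)
  corner-injective k 1F 0F eq = ⊥-elim (adjacent⇒≢ G (centre-left k) (≡.sym eq))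
  corner-injective k 1F 1F _ = ≡.refl
  corner-injective k 1F 2F eq = ⊥-elim (left≢right k eq)
  corner-injective k 2F 0F eq = ⊥-elim (adjacent⇒≢ G (centre-right k) (≡.sym eq))
  corner-injective k 2F 1F eq = ⊥-elim (left≢right k (≡.sym eq))
  corner-injective k 2F 2F _ = ≡.refl

  3*components≤order : 3 * m ≤ n
  3*components≤order = ≡.subst (_≤ n) (*-comm m 3) (injective⇒≤ {f = uncurry corner ∘ remQuot 3} λ {a} {b} eq →
    ≡.trans (≡.sym (combine-remQuot {m} 3 a))
      (≡.trans (≡.cong (uncurry combine) (pair-injective (remQuot 3 a) (remQuot 3 b) eq)) (combine-remQuot {m} 3 b)))
    where
      pair-injective : ∀ a b → uncurry corner a ≡ uncurry corner b → a ≡ b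
      pair-injective (k , i) (k′ , i′) eq
        with ≡.trans (≡.sym (comp-corner k i)) (≡.trans (≡.cong comp eq) (comp-corner k′ i′))
      ... | ≡.refl = ≡.cong (k ,_) (corner-injective k i i′ eq)

module _ {n m} {G : SimpleGraph n} (C : ComponentStructure G m) where

  open ComponentStructure C

  reachable⇒comp≡ : ∀ {u v} → Reachable G u v → comp u ≡ comp v
  reachable⇒comp≡ {u} {v} = Equivalence.from (comp-iff u v)

  comp≡⇒reachable : ∀ {u v} → comp u ≡ comp v → Reachable G u v
  comp≡⇒reachable {u} {v} = Equivalence.to (comp-iff u v)

  componentCherries : AllComponentsOrderAtLeast3 C → ComponentCherries G comp
  componentCherries order≥3 = record
    { centre = Cherry.centre ∘ cherry ; left = Cherry.left ∘ cherry ; right = Cherry.right ∘ cherry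
    ; comp-centre = comp-centre
    ; comp-left = λ k → ≡.trans (≡.sym (reachable⇒comp≡ (step (Cherry.centre-left (cherry k)) here))) (comp-centre k)
    ; comp-right = λ k → ≡.trans (≡.sym (reachable⇒comp≡ (step (Cherry.centre-right (cherry k)) here))) (comp-centre k)
    ; centre-left = Cherry.centre-left ∘ cherry
    ; centre-right = Cherry.centre-right ∘ cherry
    ; left≢right = Cherry.left≢right ∘ cherry }
    where
      rootedCherry : ∀ k → Σ (Fin n) λ u → comp u ≡ k × Cherry G u
      rootedCherry k with order≥3 k
      ... | u , v , w , u≢v , u≢w , v≢w , u∈k , v∈k , w∈k =
        u , u∈k , cherry-of-three G (comp≡⇒reachable (≡.trans u∈k (≡.sym v∈k)))
                                    (comp≡⇒reachable (≡.trans u∈k (≡.sym w∈k))) u≢v u≢w v≢w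
      cherry : ∀ k → Cherry G (proj₁ (rootedCherry k))
      cherry k = proj₂ (proj₂ (rootedCherry k))
      comp-centre : ∀ k → comp (Cherry.centre (cherry k)) ≡ k
      comp-centre k = ≡.trans (≡.sym (reachable⇒comp≡ (Cherry.reach (cherry k)))) (proj₁ (proj₂ (rootedCherry k)))

module WalkLabelling {c ℓ} (A : AbelianGroup c ℓ) {n} (G : SimpleGraph n) where

  open AbelianGroup A
  open FiniteSums A
  open import Relation.Binary.Reasoning.Setoid setoid

  Labelling : Set c
  Labelling = Fin n → Fin n → Carrier

  degree : Labelling → Fin n → Carrier
  degree L a = sum (λ b → when (adj G a b) (L a b))

  degree-∙ : ∀ L L′ a → degree (λ u v → L u v ∙ L′ u v) a ≈ degree L a ∙ degree L′ a
  degree-∙ L L′ a = trans (sum-cong-≋ {n} λ b → when-∙ (adj G a b) _ _)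
    (∑-distrib-+ (λ b → when (adj G a b) (L a b)) (λ b → when (adj G a b) (L′ a b)))

  degree-sum : ∀ {k} (L : Fin k → Labelling) a →
               degree (λ u v → sum (λ i → L i u v)) a ≈ sum (λ i → degree (L i) a)
  degree-sum L a = trans (sum-cong-≋ {n} λ b → when-sum (adj G a b) (λ i → L i a b))
    (∑-comm (λ b i → when (adj G a b) (L i a b)))

  edgeLabel : Fin n → Fin n → Carrier → Labelling
  edgeLabel u v x a b = δ a u (δ b v x) ∙ δ a v (δ b u x)

  edgeLabel-sym : ∀ u v x a b → edgeLabel u v x a b ≈ edgeLabel u v x b a
  edgeLabel-sym u v x a b = trans (comm _ _)
    (∙-cong (reflexive (δ-comm a v b u x)) (reflexive (δ-comm a u b v x)))

  δ-on-edge : ∀ {u v} x a b → adj G u v ≡ true → when (adj G a b) (δ a u (δ b v x)) ≡ δ a u (δ b v x)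
  δ-on-edge {u} {v} x a b uv with a ≟ u | b ≟ v
  ... | yes ≡.refl | yes ≡.refl rewrite uv = ≡.refl
  ... | yes _      | no _       = when-ε (adj G a b)
  ... | no _       | _          = when-ε (adj G a b)

  sum-δ-δ : ∀ (a u v : Fin n) x → sum (λ b → δ a u (δ b v x)) ≈ δ a u x
  sum-δ-δ a u v x = begin
    sum (λ b → δ a u (δ b v x)) ≡⟨ sum-cong-≗ {n} (λ b → ≡.trans (δ-comm a u b v x) (δ-sym b v _)) ⟩
    sum (λ b → δ v b (δ a u x)) ≈⟨ sum-δ v (λ _ → δ a u x) ⟩
    δ a u x                     ∎

  edgeLabel-degree : ∀ {u v} x a → adj G u v ≡ true → degree (edgeLabel u v x) a ≈ δ a u x ∙ δ a v x
  edgeLabel-degree {u} {v} x a uv = begin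
    degree (edgeLabel u v x) a
      ≈⟨ sum-cong-≋ {n} (λ b → trans (when-∙ (adj G a b) _ _)
           (reflexive (≡.cong₂ _∙_ (δ-on-edge x a b uv) (δ-on-edge x a b (≡.trans (SimpleGraph.sym G v u) uv))))) ⟩
    sum (λ b → δ a u (δ b v x) ∙ δ a v (δ b u x))
      ≈⟨ ∑-distrib-+ (λ b → δ a u (δ b v x)) (λ b → δ a v (δ b u x)) ⟩
    sum (λ b → δ a u (δ b v x)) ∙ sum (λ b → δ a v (δ b u x))
      ≈⟨ ∙-cong (sum-δ-δ a u v x) (sum-δ-δ a v u x) ⟩
    δ a u x ∙ δ a v x ∎

  startValue : ∀ {s t} → Reachable G s t → Carrier → Carrier
  startValue here       x = x ⁻¹
  startValue (step _ W) x = startValue W x ⁻¹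

  walkLabel : ∀ {s t} → Reachable G s t → Carrier → Labelling
  walkLabel here                 x a b = ε
  walkLabel (step {u} {v} _ W) x a b = edgeLabel u v (startValue W x ⁻¹) a b ∙ walkLabel W x a b

  walkLabel-sym : ∀ {s t} (W : Reachable G s t) x a b → walkLabel W x a b ≈ walkLabel W x b a
  walkLabel-sym here       x a b = refl
  walkLabel-sym (step _ W) x a b = ∙-cong (edgeLabel-sym _ _ _ a b) (walkLabel-sym W x a b)

  walkLabel-degree : ∀ {s t} (W : Reachable G s t) x a →
                     degree (walkLabel W x) a ≈ δ a s (startValue W x) ∙ δ a t x
  walkLabel-degree {s} here x a = begin
    degree (λ _ _ → ε) a       ≈⟨ sum-zero {n} (λ b → reflexive (when-ε (adj G a b))) ⟩
    ε                          ≈⟨ when-inverseˡ _ x ⟨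
    δ a s (x ⁻¹) ∙ δ a s x     ∎
  walkLabel-degree {u} {t} (step {v = v} uv W) x a = begin
    degree (walkLabel (step uv W) x) a
      ≈⟨ degree-∙ (edgeLabel u v (y ⁻¹)) (walkLabel W x) a ⟩
    degree (edgeLabel u v (y ⁻¹)) a ∙ degree (walkLabel W x) a
      ≈⟨ ∙-cong (edgeLabel-degree (y ⁻¹) a uv) (walkLabel-degree W x a) ⟩
    (δ a u (y ⁻¹) ∙ δ a v (y ⁻¹)) ∙ (δ a v y ∙ δ a t x)
      ≈⟨ assoc _ _ _ ⟩
    δ a u (y ⁻¹) ∙ (δ a v (y ⁻¹) ∙ (δ a v y ∙ δ a t x))
      ≈⟨ ∙-congˡ (assoc _ _ _) ⟨
    δ a u (y ⁻¹) ∙ ((δ a v (y ⁻¹) ∙ δ a v y) ∙ δ a t x)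
      ≈⟨ ∙-congˡ (trans (∙-congʳ (when-inverseˡ _ y)) (identityˡ _)) ⟩
    δ a u (y ⁻¹) ∙ δ a t x ∎
    where
      y : Carrier
      y = startValue W x

  module Rooted (root : Fin n → Fin n) (walk : ∀ u → Reachable G (root u) u) (target : Fin n → Carrier) where

    rootedLabel : Labelling
    rootedLabel a b = sum (λ u → walkLabel (walk u) (target u) a b)

    rootedLabel-sym : ∀ a b → rootedLabel a b ≈ rootedLabel b a
    rootedLabel-sym a b = sum-cong-≋ {n} λ u → walkLabel-sym (walk u) (target u) a b

    rootedLabel-degree : ∀ a →
      degree rootedLabel a ≈ sum (λ u → δ a (root u) (startValue (walk u) (target u))) ∙ target a
    rootedLabel-degree a = begin
      degree rootedLabel a
        ≈⟨ degree-sum (λ u → walkLabel (walk u) (target u)) a ⟩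
      sum (λ u → degree (walkLabel (walk u) (target u)) a)
        ≈⟨ sum-cong-≋ {n} (λ u → walkLabel-degree (walk u) (target u) a) ⟩
      sum (λ u → δ a (root u) (startValue (walk u) (target u)) ∙ δ a u (target u))
        ≈⟨ ∑-distrib-+ (λ u → δ a (root u) (startValue (walk u) (target u))) (λ u → δ a u (target u)) ⟩
      sum (λ u → δ a (root u) (startValue (walk u) (target u))) ∙ sum (λ u → δ a u (target u))
        ≈⟨ ∙-congˡ (sum-δ a target) ⟩
      sum (λ u → δ a (root u) (startValue (walk u) (target u))) ∙ target a ∎

module CherryLabelling (A : AbelianGroup 0ℓ 0ℓ) {n m} {G : SimpleGraph n} (C : ComponentStructure G m)
       (cherries : ComponentCherries G (ComponentStructure.comp C)) (ev : Fin n → AbelianGroup.Carrier A) where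

  open AbelianGroup A
  open FiniteSums A
  open WalkLabelling A G
  open ComponentStructure C using (comp)
  open ComponentCherries cherries
  open import Relation.Binary.Reasoning.Setoid setoid

  Corner : Fin m → Fin n → Set
  Corner k v = ∃ λ i → corner k i ≡ v

  corner? : ∀ k v → Dec (Corner k v)
  corner? k v = any? (λ i → corner k i ≟ v)

  Free : Fin n → Set
  Free v = ¬ Corner (comp v) v

  cornerValue : Carrier → Carrier → Carrier → Fin 3 → Carrier
  cornerValue d x y 0F = d ∙ x ∙ y
  cornerValue d x y 1F = x
  cornerValue d x y 2F = y

  baseTarget : Fin n → Carrier
  baseTarget v = if does (corner? (comp v) v) then ε else ev v

  open Rooted (centre ∘ comp) (λ u → comp≡⇒reachable C (comp-centre (comp u))) baseTarget

  baseDegree : Fin n → Carrier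
  baseDegree = degree rootedLabel

  offset : Fin m → Carrier
  offset k = baseDegree (centre k)

  cherryLabel : Fin m → Carrier × Carrier → Labelling
  cherryLabel k (x , y) a b = edgeLabel (centre k) (left k) x a b ∙ edgeLabel (centre k) (right k) y a b

  label : (Fin m → Carrier × Carrier) → Labelling
  label s a b = rootedLabel a b ∙ sum (λ k → cherryLabel k (s k) a b)

  weight : Fin n → Carrier × Carrier → Carrier
  weight v Q = baseDegree v ∙ degree (cherryLabel (comp v) Q) v

  cherryLabel-sym : ∀ k Q a b → cherryLabel k Q a b ≈ cherryLabel k Q b a
  cherryLabel-sym k (x , y) a b = ∙-cong (edgeLabel-sym _ _ x a b) (edgeLabel-sym _ _ y a b)

  cherryLabel-degree : ∀ k x y v → degree (cherryLabel k (x , y)) v ≈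
    (δ v (corner k 0F) x ∙ δ v (corner k 1F) x) ∙ (δ v (corner k 0F) y ∙ δ v (corner k 2F) y)
  cherryLabel-degree k x y v = trans (degree-∙ (edgeLabel (centre k) (left k) x) (edgeLabel (centre k) (right k) y) v)
    (∙-cong (edgeLabel-degree x v (centre-left k)) (edgeLabel-degree y v (centre-right k)))

  cherryLabel-degree-away : ∀ k Q v → ¬ Corner k v → degree (cherryLabel k Q) v ≈ ε
  cherryLabel-degree-away k (x , y) v away = begin
    degree (cherryLabel k (x , y)) v ≈⟨ cherryLabel-degree k x y v ⟩
    (δ v (corner k 0F) x ∙ δ v (corner k 1F) x) ∙ (δ v (corner k 0F) y ∙ δ v (corner k 2F) y)
      ≡⟨ ≡.cong₂ _∙_ (≡.cong₂ _∙_ (off 0F x) (off 1F x)) (≡.cong₂ _∙_ (off 0F y) (off 2F y)) ⟩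
    (ε ∙ ε) ∙ (ε ∙ ε) ≈⟨ trans (∙-cong (identityˡ ε) (identityˡ ε)) (identityˡ ε) ⟩
    ε ∎
    where
      off : ∀ i z → δ v (corner k i) z ≡ ε
      off i z = δ-≢ z λ v≡ → away (i , ≡.sym v≡)

  δ-corner : ∀ k i j z → δ (corner k i) (corner k j) z ≡ δ i j z
  δ-corner k i j z with i ≟ j
  ... | yes ≡.refl = δ-self (corner k i) z
  ... | no i≢j = δ-≢ z (i≢j ∘ corner-injective k i j)

  cherryLabel-degree-corner : ∀ k i x y → degree (cherryLabel k (x , y)) (corner k i) ≈
    (δ i 0F x ∙ δ i 1F x) ∙ (δ i 0F y ∙ δ i 2F y)
  cherryLabel-degree-corner k i x y = trans (cherryLabel-degree k x y (corner k i))
    (reflexive (≡.cong₂ _∙_ (≡.cong₂ _∙_ (δ-corner k i 0F x) (δ-corner k i 1F x))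
                            (≡.cong₂ _∙_ (δ-corner k i 0F y) (δ-corner k i 2F y))))

  baseDegree-noncentre : ∀ v → v ≢ centre (comp v) → baseDegree v ≈ baseTarget v
  baseDegree-noncentre v v≢centre = begin
    baseDegree v
      ≈⟨ rootedLabel-degree v ⟩
    sum (λ u → δ v (centre (comp u)) _) ∙ baseTarget v
      ≈⟨ ∙-congʳ (sum-zero {n} λ u → reflexive (δ-≢ _ (not-root u))) ⟩
    ε ∙ baseTarget v
      ≈⟨ identityˡ _ ⟩
    baseTarget v ∎
    where
      not-root : ∀ u → v ≢ centre (comp u)
      not-root u v≡ =
        v≢centre (≡.trans v≡ (≡.cong centre (≡.sym (≡.trans (≡.cong comp v≡) (comp-centre (comp u))))))

  baseTarget-corner : ∀ k i → baseTarget (corner k i) ≡ ε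
  baseTarget-corner k i rewrite comp-corner k i | dec-true (corner? k (corner k i)) (i , ≡.refl) = ≡.refl

  weight-corner : ∀ k i x y → weight (corner k i) (x , y) ≈ cornerValue (offset k) x y i
  weight-corner k i x y rewrite comp-corner k i = weight-corner′ i
    where
      baseDegree-leaf : ∀ i → i ≢ 0F → baseDegree (corner k i) ≈ ε
      baseDegree-leaf i i≢0 = trans (baseDegree-noncentre (corner k i) λ eq →
          i≢0 (corner-injective k i 0F (≡.trans eq (≡.cong centre (comp-corner k i)))))
        (reflexive (baseTarget-corner k i))
      weight-corner′ : ∀ i → baseDegree (corner k i) ∙ degree (cherryLabel k (x , y)) (corner k i)
                             ≈ cornerValue (offset k) x y i
      weight-corner′ 0F = begin
        offset k ∙ degree (cherryLabel k (x , y)) (centre k) ≈⟨ ∙-congˡ (cherryLabel-degree-corner k 0F x y) ⟩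
        offset k ∙ ((x ∙ ε) ∙ (y ∙ ε))                     ≈⟨ ∙-congˡ (∙-cong (identityʳ x) (identityʳ y)) ⟩
        offset k ∙ (x ∙ y)                                 ≈⟨ assoc _ _ _ ⟨
        offset k ∙ x ∙ y                                   ∎
      weight-corner′ 1F = begin
        baseDegree (left k) ∙ degree (cherryLabel k (x , y)) (left k)
          ≈⟨ ∙-cong (baseDegree-leaf 1F λ ()) (cherryLabel-degree-corner k 1F x y) ⟩
        ε ∙ ((ε ∙ x) ∙ (ε ∙ ε))
          ≈⟨ trans (identityˡ _) (trans (∙-cong (identityˡ x) (identityˡ ε)) (identityʳ x)) ⟩
        x ∎
      weight-corner′ 2F = begin
        baseDegree (right k) ∙ degree (cherryLabel k (x , y)) (right k)
          ≈⟨ ∙-cong (baseDegree-leaf 2F λ ()) (cherryLabel-degree-corner k 2F x y) ⟩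
        ε ∙ ((ε ∙ ε) ∙ (ε ∙ y))
          ≈⟨ trans (identityˡ _) (trans (∙-cong (identityˡ ε) (identityˡ y)) (identityˡ y)) ⟩
        y ∎

  weight-free : ∀ v Q → Free v → weight v Q ≈ ev v
  weight-free v Q free = begin
    baseDegree v ∙ degree (cherryLabel (comp v) Q) v
      ≈⟨ ∙-cong (baseDegree-noncentre v λ eq → free (0F , ≡.sym eq)) (cherryLabel-degree-away (comp v) Q v free) ⟩
    baseTarget v ∙ ε
      ≈⟨ identityʳ _ ⟩
    baseTarget v
      ≡⟨ ≡.cong (if_then ε else ev v) (dec-false (corner? (comp v) v) free) ⟩
    ev v ∎

  label-degree : ∀ s v → degree (label s) v ≈ weight v (s (comp v))
  label-degree s v = begin
    degree (label s) v
      ≈⟨ degree-∙ rootedLabel (λ a b → sum (λ k → cherryLabel k (s k) a b)) v ⟩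
    baseDegree v ∙ degree (λ a b → sum (λ k → cherryLabel k (s k) a b)) v
      ≈⟨ ∙-congˡ (degree-sum (λ k → cherryLabel k (s k)) v) ⟩
    baseDegree v ∙ sum (λ k → degree (cherryLabel k (s k)) v)
      ≈⟨ ∙-congˡ (sum-supported _ (comp v) λ k k≢ → cherryLabel-degree-away k (s k) v λ (i , eq) →
           k≢ (≡.trans (≡.sym (comp-corner k i)) (≡.cong comp eq))) ⟩
    weight v (s (comp v)) ∎

  labelling : (Fin m → Carrier × Carrier) → EdgeLabeling A G
  labelling s = record
    { lab = label s
    ; lab-sym = λ a b → ∙-cong (rootedLabel-sym a b) (sum-cong-≋ {m} λ k → cherryLabel-sym k (s k) a b) }

  weightedDegree-labelling : ∀ s v → weightedDegree A (labelling s) v ≈ weight v (s (comp v))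
  weightedDegree-labelling s v = trans (reflexive (gsum≡sum A (λ b → when (adj G v b) (label s v b)))) (label-degree s v)

module Greedy (A : AbelianGroup 0ℓ 0ℓ) {p} (order : HasOrder A p)
       {n m} {G : SimpleGraph n} (C : ComponentStructure G m)
       (cherries : ComponentCherries G (ComponentStructure.comp C))
       (ev : Fin n → AbelianGroup.Carrier A) (ev-injective : ∀ u v → AbelianGroup._≈_ A (ev u) (ev v) → u ≡ v)
       (size : 2 * n ≤ p + 3) where

  open AbelianGroup A
  open FreshValues A order
  open ComponentStructure C using (comp)
  open ComponentCherries cherries
  open CherryLabelling A C cherries ev

  value : (Fin m → Carrier × Carrier) → Fin n → Carrier
  value s v = weight v (s (comp v))

  DistinctOn : (Fin n → Set) → (Fin n → Carrier) → Set
  DistinctOn P f = ∀ u v → P u → P v → f u ≈ f v → u ≡ v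

  Done : List (Fin m) → Fin n → Set
  Done ks v = Free v ⊎ comp v ∈ ks

  others : Fin m → List (Fin n)
  others k = without (corner k 0F) (without (corner k 1F) (without (corner k 2F) (allFin n)))

  ∈-others : ∀ k v → ¬ Corner k v → v ∈ others k
  ∈-others k v non-corner =
    ∈-without (∈-without (∈-without (∈-allFin v) (ne 2F)) (ne 1F)) (ne 0F)
    where
      ne : ∀ i → v ≢ corner k i
      ne i v≡ = non-corner (i , ≡.sym v≡)

  length-others : ∀ k → 3 + length (others k) ≤ n
  length-others k = begin
    3 + length (others k)
      ≤⟨ s≤s (s≤s (length-without (∈-without (∈-without (∈-allFin (corner k 0F)) (ne 0F 2F λ ())) (ne 0F 1F λ ())))) ⟩
    2 + length without₁₂
      ≤⟨ s≤s (length-without (∈-without (∈-allFin (corner k 1F)) (ne 1F 2F λ ()))) ⟩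
    1 + length without₂
      ≤⟨ length-without (∈-allFin (corner k 2F)) ⟩
    length (allFin n)
      ≡⟨ length-tabulate (λ v → v) ⟩
    n ∎
    where
      open ≤-Reasoning
      ne : ∀ i j → i ≢ j → corner k i ≢ corner k j
      ne i j i≢j = i≢j ∘ corner-injective k i j
      without₂ without₁₂ : List (Fin n)
      without₂ = without (corner k 2F) (allFin n)
      without₁₂ = without (corner k 1F) without₂

  module Step (k : Fin m) (ks : List (Fin m)) (s : Fin m → Carrier × Carrier)
              (distinct : DistinctOn (Done ks) (value s)) where

    forbidden : List Carrier
    forbidden = map (value s) (others k)

    triple : FreshTriple forbidden (offset k)
    triple = freshTriple forbidden (offset k) (≡.subst (λ l → 2 * l + 2 < p) (≡.sym (length-map (value s) (others k)))
                                                       (3+l≤n⇒2*l+2<p (length-others k) size))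

    open FreshTriple triple

    s′ : Fin m → Carrier × Carrier
    s′ = updateAt s k (const (x , y))

    value-corner : ∀ i → value s′ (corner k i) ≈ cornerValue (offset k) x y i
    value-corner i = trans (reflexive (≡.cong (weight (corner k i)) s′-corner)) (weight-corner k i x y)
      where
        s′-corner : s′ (comp (corner k i)) ≡ (x , y)
        s′-corner = ≡.trans (≡.cong s′ (comp-corner k i)) (updateAt-updates k s)

    value-unchanged : ∀ v → ¬ Corner k v → value s′ v ≈ value s v
    value-unchanged v non-corner = unchanged (comp v ≟ k)
      where
        unchanged : Dec (comp v ≡ k) → value s′ v ≈ value s v
        unchanged (yes comp≡k) = trans (weight-free v (s′ (comp v)) free) (sym (weight-free v (s (comp v)) free))
          where
            free : Free v
            free = ≡.subst (λ j → ¬ Corner j v) (≡.sym comp≡k) non-corner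
        unchanged (no comp≢k) = reflexive (≡.cong (weight v) (updateAt-minimal (comp v) k s comp≢k))

    classify : ∀ v → Done (k ∷ ks) v → Corner k v ⊎ (¬ Corner k v × Done ks v)
    classify v done with corner? k v
    classify v done                      | yes corner = inj₁ corner
    classify v (inj₁ free)               | no non-corner = inj₂ (non-corner , inj₁ free)
    classify v (inj₂ (here comp≡k))      | no non-corner =
      inj₂ (non-corner , inj₁ (≡.subst (λ j → ¬ Corner j v) (≡.sym comp≡k) non-corner))
    classify v (inj₂ (there comp∈ks))    | no non-corner = inj₂ (non-corner , inj₂ comp∈ks)

    cornerValue-fresh : ∀ i → Fresh (cornerValue (offset k) x y i) forbidden
    cornerValue-fresh 0F = dxy-fresh
    cornerValue-fresh 1F = x-fresh
    cornerValue-fresh 2F = y-fresh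

    corner≉other : ∀ i v → ¬ Corner k v → ¬ value s′ (corner k i) ≈ value s′ v
    corner≉other i v non-corner eq = All.lookup (cornerValue-fresh i) (∈-map⁺ (value s) (∈-others k v non-corner))
      (trans (sym (value-corner i)) (trans eq (value-unchanged v non-corner)))

    cornerValue-injective : ∀ i j → cornerValue (offset k) x y i ≈ cornerValue (offset k) x y j → i ≡ j
    cornerValue-injective 0F 0F _ = ≡.refl
    cornerValue-injective 0F 1F eq = ⊥-elim (dxy≉x eq)
    cornerValue-injective 0F 2F eq = ⊥-elim (dxy≉y eq)
    cornerValue-injective 1F 0F eq = ⊥-elim (dxy≉x (sym eq))
    cornerValue-injective 1F 1F _ = ≡.refl
    cornerValue-injective 1F 2F eq = ⊥-elim (x≉y eq)
    cornerValue-injective 2F 0F eq = ⊥-elim (dxy≉y (sym eq))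
    cornerValue-injective 2F 1F eq = ⊥-elim (x≉y (sym eq))
    cornerValue-injective 2F 2F _ = ≡.refl

    distinct′ : DistinctOn (Done (k ∷ ks)) (value s′)
    distinct′ u v du dv = by-class (classify u du) (classify v dv)
      where
        by-class : Corner k u ⊎ (¬ Corner k u × Done ks u) → Corner k v ⊎ (¬ Corner k v × Done ks v) →
                   value s′ u ≈ value s′ v → u ≡ v
        by-class (inj₁ (i , ≡.refl)) (inj₁ (j , ≡.refl)) eq =
          ≡.cong (corner k) (cornerValue-injective i j (trans (sym (value-corner i)) (trans eq (value-corner j))))
        by-class (inj₁ (i , ≡.refl)) (inj₂ (non-corner , _)) eq = ⊥-elim (corner≉other i v non-corner eq)
        by-class (inj₂ (non-corner , _)) (inj₁ (j , ≡.refl)) eq = ⊥-elim (corner≉other j u non-corner (sym eq))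
        by-class (inj₂ (nu , du′)) (inj₂ (nv , dv′)) eq =
          distinct u v du′ dv′ (trans (sym (value-unchanged u nu)) (trans eq (value-unchanged v nv)))

  done-[] : ∀ {v} → Done [] v → Free v
  done-[] (inj₁ free) = free
  done-[] (inj₂ ())

  assignment : ∀ ks → ∃ λ s → DistinctOn (Done ks) (value s)
  assignment [] = const (ε , ε) , λ u v du dv eq →
    ev-injective u v (trans (sym (weight-free u (ε , ε) (done-[] du))) (trans eq (weight-free v (ε , ε) (done-[] dv))))
  assignment (k ∷ ks) with assignment ks
  ... | s , distinct = Step.s′ k ks s distinct , Step.distinct′ k ks s distinct

  irregularAssignment : ∃ λ s → ∀ u v → value s u ≈ value s v → u ≡ v
  irregularAssignment with assignment (allFin m)
  ... | s , distinct = s , λ u v → distinct u v (inj₂ (∈-allFin (comp u))) (inj₂ (∈-allFin (comp v)))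

goodOrder : ∀ {n m p} {G : SimpleGraph n} (C : ComponentStructure G m) →
            AllComponentsOrderAtLeast3 C → 2 * n ≤ p + 3 → GoodOrder G p
goodOrder {n} {m} {p} {G} C order≥3 2n≤p+3 A order = labelling s , λ u v eq →
  distinct u v (trans (sym (weightedDegree-labelling s u)) (trans eq (weightedDegree-labelling s v)))
  where
    open AbelianGroup A using (Carrier; _≈_; sym; trans)
    cherries : ComponentCherries G (ComponentStructure.comp C)
    cherries = componentCherries C order≥3
    n≤p : n ≤ p
    n≤p = order≤p (ComponentStructure.comp C) (ComponentCherries.3*components≤order cherries) 2n≤p+3
    ev : Fin n → Carrier
    ev u = proj₁ order (inject≤ u n≤p)
    ev-injective : ∀ u v → ev u ≈ ev v → u ≡ v
    ev-injective u v eq = inject≤-injective n≤p n≤p u v (proj₁ (proj₂ order) _ _ eq)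
    open CherryLabelling A C cherries ev using (labelling; weightedDegree-labelling)
    open Greedy A order C cherries ev ev-injective 2n≤p+3 using (value; irregularAssignment)
    s : Fin m → Carrier × Carrier
    s = proj₁ irregularAssignment
    distinct : ∀ u v → value s u ≈ value s v → u ≡ v
    distinct = proj₂ irregularAssignment

theorem2p1 : (n m : ℕ) (G : SimpleGraph n) (C : ComponentStructure G m) →
    AllComponentsOrderAtLeast3 C →
    (p : ℕ) → IsSmallestPrimeAbove (2 ^ (n ∸ m ∸ 1)) p →
    sg≤ G p
theorem2p1 n m G C order≥3 p (_ , 2^e<p , _) =
  p , ≤-trans (s≤s z≤n) 2^e<p , ≤-refl , goodOrder C order≥3 (2*order≤p+3 {n} {m} 3m≤n 2^e<p)
  where
    3m≤n : 3 * m ≤ n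
    3m≤n = ComponentCherries.3*components≤order (componentCherries C order≥3)
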